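{- For every integer $k\ge 2$, there exist a connected split graph $G=(K\uplus S,E)$ and two D$2$DSs $D_s,D_t$ of $G$, each of size $k$, such that $\mathrm{opt}_{\mathsf{TJ}}(G,D_s,D_t)=M^\star_{\mathsf{TJ}}(G,D_s,D_t)+1$.
   Context: A split graph $G=(K\uplus S,E)$ has vertex set partitioned into a clique $K$ and an independent set $S$. A D$2$DS of $G$ is a set $D\subseteq V(G)$ such that every vertex is at distance at most $2$ from some vertex of $D$. A $\mathsf{TJ}$-sequence between D$2$DSs $D_s,D_t$ is a sequence $D_s=D_0,\dots,D_q=D_t$ of D$2$DSs with $D_i\setminus D_{i+1}=\{x_i\}$, $D_{i+1}\setminus D_i=\{y_i\}$ for each $i$; its length is $q$. $\mathrm{opt}_{\mathsf{TJ}}(G,D_s,D_t)$ is the minimum length of such a sequence ($\infty$ if none). $M^\star_{\mathsf{TJ}}(G,D_s,D_t)=|D_s\,\Delta\,D_t|/2$. -}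

module Defs where

open import Data.Nat using (ℕ; zero; suc; _≤_; _+_; ⌊_/2⌋)
open import Data.Bool using (Bool; true; false; _∧_)
open import Data.Fin using (Fin)
open import Data.Fin.Subset using (Subset; _∈_; _∉_; _∪_; _∩_; _─_; ∣_∣)
open import Data.Product using (Σ; ∃; _×_; _,_)
open import Data.Sum using (_⊎_)
open import Relation.Nullary using (¬_)
open import Relation.Binary.PropositionalEquality using (_≡_; _≢_)
open import Function.Bundles using (_⇔_)

record Graph (n : ℕ) : Set where
  field
    adj    : Fin n → Fin n → Bool
    sym    : ∀ u v → adj u v ≡ adj v u
    irrefl : ∀ u → adj u u ≡ false

open Graph public

module _ {n : ℕ} (G : Graph n) where

  Adj : Fin n → Fin n → Set
  Adj u v = adj G u v ≡ true

  data Reach : Fin n → Fin n → Set where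
    reach-refl : ∀ {u} → Reach u u
    reach-step : ∀ {u v w} → Adj u v → Reach v w → Reach u w

  IsConnected : Set
  IsConnected = ∀ u v → Reach u v

  IsSplit : Set
  IsSplit = Σ (Fin n → Bool) λ inK →
      (∀ u v → u ≢ v → inK u ≡ true → inK v ≡ true → Adj u v)
    × (∀ u v → inK u ≡ false → inK v ≡ false → ¬ Adj u v)

  Dist≤2 : Fin n → Fin n → Set
  Dist≤2 u v = u ≡ v ⊎ Adj u v ⊎ ∃ λ w → Adj u w × Adj w v

  IsD2DS : Subset n → Set
  IsD2DS D = ∀ v → ∃ λ u → u ∈ D × Dist≤2 u v

  TJStep : Subset n → Subset n → Set
  TJStep D D' = Σ (Fin n) λ x → Σ (Fin n) λ y →
      x ∈ D × x ∉ D' × y ∉ D × y ∈ D'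
    × (∀ z → z ≢ x → z ≢ y → (z ∈ D ⇔ z ∈ D'))

  data TJSeq : Subset n → Subset n → ℕ → Set where
    tj-done : ∀ {D} → IsD2DS D → TJSeq D D 0
    tj-step : ∀ {D D' D'' q} → IsD2DS D → TJStep D D' → TJSeq D' D'' q
            → TJSeq D D'' (suc q)

  OptTJ≡ : Subset n → Subset n → ℕ → Set
  OptTJ≡ Ds Dt m = TJSeq Ds Dt m × (∀ q → TJSeq Ds Dt q → m ≤ q)

Mstar : {n : ℕ} → Subset n → Subset n → ℕ
Mstar Ds Dt = ⌊ ∣ (Ds ∪ Dt) ─ (Ds ∩ Dt) ∣ /2⌋

-- The gadget is a split graph with clique k₀ … k₄; the tokens s₁, s₂ of Ds and t₁, t₂ of Dt
-- are attached to the clique along the 8-cycle s₁ k₁ t₁ k₄ s₂ k₂ t₂ k₃, each kᵢ (i ≥ 1) carries a pendant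
-- pᵢ, and k − 2 further pendants of k₀ lie in both sets, so M* = 2. Three jumps suffice: s₂ ↦ k₁ (k₁
-- alone dominates the gadget), s₁ ↦ t₁, k₁ ↦ t₂. Two do not: the middle set D₁ must then lie inside
-- Ds ∪ Dt and hold at most one sᵢ and at most one tⱼ, while dominating pᵢ forces it to contain one of the
-- two tokens adjacent to kᵢ; these four pairs form a 4-cycle on s₁, t₁, s₂, t₂ that no such choice covers.

module Submission where

open import Defs
open import Data.Nat using (ℕ; suc; _+_; _≤_; z≤n; s≤s; ⌊_/2⌋; _<ᵇ_)
open import Data.Bool using (Bool; true; false; _∧_; _∨_; not)
import Data.Bool.Properties as Bool
open import Data.Fin using (Fin; zero; suc; toℕ; _↑ˡ_; _↑ʳ_; splitAt; _≟_)
open import Data.Fin.Properties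
  using (splitAt-↑ˡ; splitAt-↑ʳ; splitAt⁻¹-↑ˡ; splitAt⁻¹-↑ʳ; ↑ˡ-injective; all?; any?)
open import Data.Fin.Subset using (Subset; inside; outside; _∈_; _∉_; ⁅_⁆; _∪_; _∩_; _─_; ∣_∣; ⊤)
open import Data.Fin.Subset.Properties using (_∈?_; ∈⊤; ∣⊤∣≡n)
open import Data.Vec using ([]; _∷_; here; there; _++_; lookup; _[_]≔_)
open import Data.Vec.Properties using (lookup∘update; lookup∘update′; []=⇒lookup; lookup⇒[]=)
open import Data.Product using (Σ; _×_; _,_; proj₁; proj₂)
open import Data.Sum using (_⊎_; inj₁; inj₂; [_,_]′)
import Data.Sum as Sum
open import Data.Empty using (⊥; ⊥-elim)
open import Function using (_∘_; const)
open import Function.Bundles using (_⇔_; mk⇔; Equivalence)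
open import Relation.Nullary using (¬_; Dec; yes; no; does; contradiction)
open import Relation.Nullary.Decidable
  using (True; False; toWitness; toWitnessFalse; from-yes; dec-true; ¬?; _×-dec_; _⊎-dec_; _→-dec_)
open import Relation.Binary.PropositionalEquality as ≡ using (_≡_; _≢_; refl; trans; cong; subst)

↑ˡ-∈-++⁺ : ∀ {n m} {p : Subset n} {q : Subset m} {i} → i ∈ p → i ↑ˡ m ∈ p ++ q
↑ˡ-∈-++⁺ here      = here
↑ˡ-∈-++⁺ (there x) = there (↑ˡ-∈-++⁺ x)

↑ˡ-∈-++⁻ : ∀ {n m} (p : Subset n) {q : Subset m} i → i ↑ˡ m ∈ p ++ q → i ∈ p
↑ˡ-∈-++⁻ (_ ∷ _) zero    here      = here
↑ˡ-∈-++⁻ (_ ∷ p) (suc i) (there x) = there (↑ˡ-∈-++⁻ p i x)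

↑ʳ-∈-++⁺ : ∀ {n m} (p : Subset n) {q : Subset m} {j} → j ∈ q → n ↑ʳ j ∈ p ++ q
↑ʳ-∈-++⁺ []      x = x
↑ʳ-∈-++⁺ (_ ∷ p) x = there (↑ʳ-∈-++⁺ p x)

∣p++q∣≡∣p∣+∣q∣ : ∀ {n m} (p : Subset n) (q : Subset m) → ∣ p ++ q ∣ ≡ ∣ p ∣ + ∣ q ∣
∣p++q∣≡∣p∣+∣q∣ []            q = refl
∣p++q∣≡∣p∣+∣q∣ (outside ∷ p) q = ∣p++q∣≡∣p∣+∣q∣ p q
∣p++q∣≡∣p∣+∣q∣ (inside  ∷ p) q = cong suc (∣p++q∣≡∣p∣+∣q∣ p q)

∣p∪p─p∩p∣≡0 : ∀ {n} (p : Subset n) → ∣ (p ∪ p) ─ (p ∩ p) ∣ ≡ 0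
∣p∪p─p∩p∣≡0 []            = refl
∣p∪p─p∩p∣≡0 (outside ∷ p) = ∣p∪p─p∩p∣≡0 p
∣p∪p─p∩p∣≡0 (inside  ∷ p) = ∣p∪p─p∩p∣≡0 p

Mstar-++ : ∀ {n m} (p q : Subset n) (r : Subset m) → Mstar (p ++ r) (q ++ r) ≡ Mstar p q
Mstar-++ p q r = cong ⌊_/2⌋ (symmetric-difference p q)
  where
  symmetric-difference : ∀ {n} (p q : Subset n) →
    ∣ ((p ++ r) ∪ (q ++ r)) ─ ((p ++ r) ∩ (q ++ r)) ∣ ≡ ∣ (p ∪ q) ─ (p ∩ q) ∣
  symmetric-difference []            []            = ∣p∪p─p∩p∣≡0 r
  symmetric-difference (outside ∷ p) (outside ∷ q) = symmetric-difference p q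
  symmetric-difference (outside ∷ p) (inside  ∷ q) = cong suc (symmetric-difference p q)
  symmetric-difference (inside  ∷ p) (outside ∷ q) = cong suc (symmetric-difference p q)
  symmetric-difference (inside  ∷ p) (inside  ∷ q) = symmetric-difference p q

module _ {n : ℕ} (G : Graph n) where

  adj? : ∀ u v → Dec (Adj G u v)
  adj? u v = adj G u v Bool.≟ true

  dist≤2? : ∀ u v → Dec (Dist≤2 G u v)
  dist≤2? u v = u ≟ v ⊎-dec adj? u v ⊎-dec any? (λ w → adj? u w ×-dec adj? w v)

  isD2DS? : ∀ D → Dec (IsD2DS G D)
  isD2DS? D = all? (λ v → any? (λ u → u ∈? D ×-dec dist≤2? u v))

  Reach-trans : ∀ {u v w} → Reach G u v → Reach G v w → Reach G u w
  Reach-trans reach-refl        r′ = r′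
  Reach-trans (reach-step uv r) r′ = reach-step uv (Reach-trans r r′)

  Reach-sym : ∀ {u v} → Reach G u v → Reach G v u
  Reach-sym reach-refl                = reach-refl
  Reach-sym (reach-step {u} {v} uv r) =
    Reach-trans (Reach-sym r) (reach-step (trans (sym G v u) uv) reach-refl)

  Dist≤2⇒Reach : ∀ {u v} → Dist≤2 G u v → Reach G u v
  Dist≤2⇒Reach (inj₁ refl)                 = reach-refl
  Dist≤2⇒Reach (inj₂ (inj₁ uv))            = reach-step uv reach-refl
  Dist≤2⇒Reach (inj₂ (inj₂ (w , uw , wv))) = reach-step uw (reach-step wv reach-refl)

  radius≤2⇒connected : (c : Fin n) → (∀ u → Dist≤2 G u c) → IsConnected G
  radius≤2⇒connected c near u v =
    Reach-trans (Dist≤2⇒Reach (near u)) (Reach-sym (Dist≤2⇒Reach (near v)))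

module _ {n : ℕ} (G : Graph n) {D D′ : Subset n} where

  removed-token : ∀ {z} (step : TJStep G D D′) → z ∈ D → z ∉ D′ → z ≡ proj₁ step
  removed-token {z} (x , y , _ , _ , y∉D , _ , frame) z∈D z∉D′ with z ≟ x | z ≟ y
  ... | yes z≡x | _        = z≡x
  ... | no _    | yes refl = contradiction z∈D y∉D
  ... | no z≢x  | no z≢y   = contradiction (Equivalence.to (frame z z≢x z≢y) z∈D) z∉D′

  added-token : ∀ {z} (step : TJStep G D D′) → z ∉ D → z ∈ D′ → z ≡ proj₁ (proj₂ step)
  added-token {z} (x , y , x∈D , x∉D′ , _ , _ , frame) z∉D z∈D′ with z ≟ y | z ≟ x
  ... | yes z≡y | _        = z≡y
  ... | no _    | yes refl = contradiction z∈D′ x∉D′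
  ... | no z≢y  | no z≢x   = contradiction (Equivalence.from (frame z z≢x z≢y) z∈D′) z∉D

  TJStep-removes-one : ∀ {a b} → TJStep G D D′ → a ∈ D → a ∉ D′ → b ∈ D → b ∉ D′ → a ≡ b
  TJStep-removes-one step a∈D a∉D′ b∈D b∉D′ =
    trans (removed-token step a∈D a∉D′) (≡.sym (removed-token step b∈D b∉D′))

  TJStep-adds-one : ∀ {a b} → TJStep G D D′ → a ∉ D → a ∈ D′ → b ∉ D → b ∈ D′ → a ≡ b
  TJStep-adds-one step a∉D a∈D′ b∉D b∈D′ =
    trans (added-token step a∉D a∈D′) (≡.sym (added-token step b∉D b∈D′))

two-steps-stay-within : ∀ {n} (G : Graph n) {D D₁ D′ : Subset n} {a b z} →
  TJStep G D D₁ → TJStep G D₁ D′ → a ≢ b → a ∈ D → a ∉ D′ → b ∈ D → b ∉ D′ →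
  z ∈ D₁ → z ∈ D ⊎ z ∈ D′
two-steps-stay-within G {D} {D₁} {D′} {a} {b} {z} step step′ a≢b a∈D a∉D′ b∈D b∉D′ z∈D₁
  with z ∈? D | z ∈? D′
... | yes z∈D | _        = inj₁ z∈D
... | no _    | yes z∈D′ = inj₂ z∈D′
... | no z∉D  | no z∉D′  =
  contradiction (TJStep-removes-one G step a∈D (left a∈D a∉D′) b∈D (left b∈D b∉D′)) a≢b
  where
  -- a token of D ─ D′ still present in D₁ would leave in the second step together with z
  left : ∀ {c} → c ∈ D → c ∉ D′ → c ∉ D₁
  left c∈D c∉D′ c∈D₁ = z∉D (subst (_∈ D) (TJStep-removes-one G step′ c∈D₁ c∉D′ z∈D₁ z∉D′) c∈D)

lookup-≡⇒∈-⇔ : ∀ {n} {p q : Subset n} {z} → lookup p z ≡ lookup q z → z ∈ p ⇔ z ∈ q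
lookup-≡⇒∈-⇔ {p = p} {q} {z} eq =
  mk⇔ (λ z∈p → lookup⇒[]= z q (trans (≡.sym eq) ([]=⇒lookup z∈p)))
      (λ z∈q → lookup⇒[]= z p (trans eq ([]=⇒lookup z∈q)))

swap : ∀ {n} → Subset n → Fin n → Fin n → Subset n
swap D x y = D [ x ]≔ outside [ y ]≔ inside

swap-TJStep : ∀ {n} (G : Graph n) {D : Subset n} {x y} → x ∈ D → y ∉ D → TJStep G D (swap D x y)
swap-TJStep G {D} {x} {y} x∈D y∉D = x , y , x∈D , x∉swap , y∉D , y∈swap , unchanged
  where
  D-x : Subset _
  D-x = D [ x ]≔ outside

  x≢y : x ≢ y
  x≢y refl = y∉D x∈D

  x∉swap : x ∉ swap D x y
  x∉swap x∈
    with trans (≡.sym ([]=⇒lookup x∈)) (trans (lookup∘update′ x≢y D-x inside) (lookup∘update x D outside))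
  ... | ()

  y∈swap : y ∈ swap D x y
  y∈swap = lookup⇒[]= y _ (lookup∘update y D-x inside)

  unchanged : ∀ z → z ≢ x → z ≢ y → z ∈ D ⇔ z ∈ swap D x y
  unchanged z z≢x z≢y =
    lookup-≡⇒∈-⇔ (≡.sym (trans (lookup∘update′ z≢y D-x inside) (lookup∘update′ z≢x D outside)))

module Attach {n : ℕ} (H : Graph n) (r : Fin n) (m : ℕ) where

  data Part : Fin (n + m) → Set where
    old : (i : Fin n) → Part (i ↑ˡ m)
    new : (e : Fin m) → Part (n ↑ʳ e)

  part : (u : Fin (n + m)) → Part u
  part u with splitAt n u in eq
  ... | inj₁ i = subst Part (splitAt⁻¹-↑ˡ eq) (old i)
  ... | inj₂ e = subst Part (splitAt⁻¹-↑ʳ eq) (new e)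

  attached : Fin n ⊎ Fin m → Fin n ⊎ Fin m → Bool
  attached (inj₁ i) (inj₁ j) = adj H i j
  attached (inj₁ i) (inj₂ _) = does (i ≟ r)
  attached (inj₂ _) (inj₁ j) = does (j ≟ r)
  attached (inj₂ _) (inj₂ _) = false

  attached-sym : ∀ a b → attached a b ≡ attached b a
  attached-sym (inj₁ i) (inj₁ j) = sym H i j
  attached-sym (inj₁ i) (inj₂ _) = refl
  attached-sym (inj₂ _) (inj₁ j) = refl
  attached-sym (inj₂ _) (inj₂ _) = refl

  attached-irrefl : ∀ a → attached a a ≡ false
  attached-irrefl (inj₁ i) = irrefl H i
  attached-irrefl (inj₂ _) = refl

  attach : Graph (n + m)
  attach = record
    { adj    = λ u v → attached (splitAt n u) (splitAt n v)
    ; sym    = λ u v → attached-sym (splitAt n u) (splitAt n v)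
    ; irrefl = λ u → attached-irrefl (splitAt n u)
    }

  adj-old-old : ∀ i j → adj attach (i ↑ˡ m) (j ↑ˡ m) ≡ adj H i j
  adj-old-old i j rewrite splitAt-↑ˡ n i m | splitAt-↑ˡ n j m = refl

  adj-new-old : ∀ e j → adj attach (n ↑ʳ e) (j ↑ˡ m) ≡ does (j ≟ r)
  adj-new-old e j rewrite splitAt-↑ʳ n m e | splitAt-↑ˡ n j m = refl

  adj-new-new : ∀ e e′ → adj attach (n ↑ʳ e) (n ↑ʳ e′) ≡ false
  adj-new-new e e′ rewrite splitAt-↑ʳ n m e | splitAt-↑ʳ n m e′ = refl

  Adj-old-old⁺ : ∀ {i j} → Adj H i j → Adj attach (i ↑ˡ m) (j ↑ˡ m)
  Adj-old-old⁺ {i} {j} = trans (adj-old-old i j)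

  Adj-old-old⁻ : ∀ {i j} → Adj attach (i ↑ˡ m) (j ↑ˡ m) → Adj H i j
  Adj-old-old⁻ {i} {j} = trans (≡.sym (adj-old-old i j))

  Adj-new-old⇒root : ∀ {e j} → Adj attach (n ↑ʳ e) (j ↑ˡ m) → j ≡ r
  Adj-new-old⇒root {e} {j} a with j ≟ r | trans (≡.sym (adj-new-old e j)) a
  ... | yes j≡r | _ = j≡r
  ... | no _    | ()

  Adj-old-new⇒root : ∀ {i e} → Adj attach (i ↑ˡ m) (n ↑ʳ e) → i ≡ r
  Adj-old-new⇒root {i} {e} a = Adj-new-old⇒root (trans (sym attach (n ↑ʳ e) (i ↑ˡ m)) a)

  ¬Adj-new-new : ∀ {e e′} → ¬ Adj attach (n ↑ʳ e) (n ↑ʳ e′)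
  ¬Adj-new-new {e} {e′} a with trans (≡.sym (adj-new-new e e′)) a
  ... | ()

  new≢old : ∀ {e i} → n ↑ʳ e ≢ i ↑ˡ m
  new≢old {e} {i} eq
    with trans (≡.sym (splitAt-↑ʳ n m e)) (trans (cong (splitAt n) eq) (splitAt-↑ˡ n i m))
  ... | ()

  Dist≤2-old⁺ : ∀ {i j} → Dist≤2 H i j → Dist≤2 attach (i ↑ˡ m) (j ↑ˡ m)
  Dist≤2-old⁺ (inj₁ refl)                  = inj₁ refl
  Dist≤2-old⁺ (inj₂ (inj₁ ij))             = inj₂ (inj₁ (Adj-old-old⁺ ij))
  Dist≤2-old⁺ (inj₂ (inj₂ (w , iw , wj))) = inj₂ (inj₂ (w ↑ˡ m , Adj-old-old⁺ iw , Adj-old-old⁺ wj))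

  -- a detour through a new vertex w forces both ends to be the root
  Dist≤2-old⁻ : ∀ {i j} → Dist≤2 attach (i ↑ˡ m) (j ↑ˡ m) → Dist≤2 H i j
  Dist≤2-old⁻ {i} {j} (inj₁ eq)       = inj₁ (↑ˡ-injective m i j eq)
  Dist≤2-old⁻ (inj₂ (inj₁ ij))        = inj₂ (inj₁ (Adj-old-old⁻ ij))
  Dist≤2-old⁻ (inj₂ (inj₂ (w , iw , wj))) with part w
  ... | old k = inj₂ (inj₂ (k , Adj-old-old⁻ iw , Adj-old-old⁻ wj))
  ... | new _ = inj₁ (trans (Adj-old-new⇒root iw) (≡.sym (Adj-new-old⇒root wj)))

  Dist≤2-new-old : ∀ {e j} → Dist≤2 attach (n ↑ʳ e) (j ↑ˡ m) → r ≡ j ⊎ Adj H r j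
  Dist≤2-new-old (inj₁ eq)                = contradiction eq new≢old
  Dist≤2-new-old (inj₂ (inj₁ ej))         = inj₁ (≡.sym (Adj-new-old⇒root ej))
  Dist≤2-new-old (inj₂ (inj₂ (w , ew , wj))) with part w
  ... | old k = inj₂ (subst (λ k → Adj H k _) (Adj-new-old⇒root ew) (Adj-old-old⁻ wj))
  ... | new _ = contradiction ew ¬Adj-new-new

  attach-split : (split : IsSplit H) → proj₁ split r ≡ true → IsSplit attach
  attach-split (inK , clique , independent) r∈K = inK′ , clique′ , independent′
    where
    inK′ : Fin (n + m) → Bool
    inK′ u = [ inK , const false ]′ (splitAt n u)

    inK′-old : ∀ i → inK′ (i ↑ˡ m) ≡ inK i
    inK′-old i = cong [ inK , const false ]′ (splitAt-↑ˡ n i m)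

    inK′-new : ∀ e → inK′ (n ↑ʳ e) ≢ true
    inK′-new e eq with trans (≡.sym (cong [ inK , const false ]′ (splitAt-↑ʳ n m e))) eq
    ... | ()

    clique′ : ∀ u v → u ≢ v → inK′ u ≡ true → inK′ v ≡ true → Adj attach u v
    clique′ u v u≢v ku kv with part u | part v
    ... | old i | old j = Adj-old-old⁺
      (clique i j (u≢v ∘ cong (_↑ˡ m)) (trans (≡.sym (inK′-old i)) ku) (trans (≡.sym (inK′-old j)) kv))
    ... | old _ | new e = contradiction kv (inK′-new e)
    ... | new e | _     = contradiction ku (inK′-new e)

    root-in-K : ∀ {i} → i ≡ r → inK′ (i ↑ˡ m) ≢ false
    root-in-K refl ki with trans (≡.sym r∈K) (trans (≡.sym (inK′-old r)) ki)
    ... | ()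

    independent′ : ∀ u v → inK′ u ≡ false → inK′ v ≡ false → ¬ Adj attach u v
    independent′ u v ku kv with part u | part v
    ... | old i | old j = λ a → independent i j
      (trans (≡.sym (inK′-old i)) ku) (trans (≡.sym (inK′-old j)) kv) (Adj-old-old⁻ a)
    ... | old _ | new _ = λ a → root-in-K (Adj-old-new⇒root a) ku
    ... | new _ | old _ = λ a → root-in-K (Adj-new-old⇒root a) kv
    ... | new _ | new _ = ¬Adj-new-new

  attach-radius≤2 : (∀ i → Dist≤2 H i r) → ∀ u → Dist≤2 attach u (r ↑ˡ m)
  attach-radius≤2 near u with part u
  ... | old i = Dist≤2-old⁺ (near i)
  ... | new e = inj₂ (inj₁ (trans (adj-new-old e r) (dec-true (r ≟ r) refl)))

  lift : Subset n → Subset (n + m)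
  lift D = D ++ ⊤

  ∣lift∣ : ∀ D → ∣ lift D ∣ ≡ ∣ D ∣ + m
  ∣lift∣ D = trans (∣p++q∣≡∣p∣+∣q∣ D ⊤) (cong (∣ D ∣ +_) (∣⊤∣≡n m))

  lift-D2DS : ∀ {D} → IsD2DS H D → IsD2DS attach (lift D)
  lift-D2DS {D} dominating v with part v
  ... | old j = let (i , i∈D , ij) = dominating j in i ↑ˡ m , ↑ˡ-∈-++⁺ i∈D , Dist≤2-old⁺ ij
  ... | new e = n ↑ʳ e , ↑ʳ-∈-++⁺ D ∈⊤ , inj₁ refl

  lift-TJStep : ∀ {D D′} → TJStep H D D′ → TJStep attach (lift D) (lift D′)
  lift-TJStep {D} {D′} (x , y , x∈D , x∉D′ , y∉D , y∈D′ , frame) =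
    x ↑ˡ m , y ↑ˡ m , ↑ˡ-∈-++⁺ x∈D , x∉D′ ∘ ↑ˡ-∈-++⁻ D′ x , y∉D ∘ ↑ˡ-∈-++⁻ D y , ↑ˡ-∈-++⁺ y∈D′ , frame′
    where
    frame′ : ∀ z → z ≢ x ↑ˡ m → z ≢ y ↑ˡ m → z ∈ lift D ⇔ z ∈ lift D′
    frame′ z z≢x z≢y with part z
    ... | old i = let i∈D⇔i∈D′ = frame i (z≢x ∘ cong (_↑ˡ m)) (z≢y ∘ cong (_↑ˡ m)) in
      mk⇔ (↑ˡ-∈-++⁺ ∘ Equivalence.to i∈D⇔i∈D′ ∘ ↑ˡ-∈-++⁻ D i)
          (↑ˡ-∈-++⁺ ∘ Equivalence.from i∈D⇔i∈D′ ∘ ↑ˡ-∈-++⁻ D′ i)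
    ... | new _ = mk⇔ (const (↑ʳ-∈-++⁺ D′ ∈⊤)) (const (↑ʳ-∈-++⁺ D ∈⊤))

  lift-TJSeq : ∀ {D D′ q} → TJSeq H D D′ q → TJSeq attach (lift D) (lift D′) q
  lift-TJSeq (tj-done dominating)           = tj-done (lift-D2DS dominating)
  lift-TJSeq (tj-step dominating step rest) =
    tj-step (lift-D2DS dominating) (lift-TJStep step) (lift-TJSeq rest)

  far-vertex-dominated : ∀ {A B D p s t} → IsD2DS attach D → (∀ {u} → u ∈ D → u ∈ lift A ⊎ u ∈ lift B) →
    ¬ (r ≡ p ⊎ Adj H r p) → (∀ i → i ∈ A ⊎ i ∈ B → Dist≤2 H i p → i ≡ s ⊎ i ≡ t) →
    s ↑ˡ m ∈ D ⊎ t ↑ˡ m ∈ D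
  far-vertex-dominated {A} {B} {p = p} dominating within far near with dominating (p ↑ˡ m)
  ... | u , u∈D , up with part u
  ...   | new _ = contradiction (Dist≤2-new-old up) far
  ...   | old i with near i (Sum.map (↑ˡ-∈-++⁻ A i) (↑ˡ-∈-++⁻ B i) (within u∈D)) (Dist≤2-old⁻ up)
  ...     | inj₁ refl = inj₁ u∈D
  ...     | inj₂ refl = inj₂ u∈D

¬-C₄-cover-one-per-side : ∀ {a b} {A₁ A₂ : Set a} {B₁ B₂ : Set b} →
  ¬ (A₁ × A₂) → ¬ (B₁ × B₂) → A₁ ⊎ B₁ → A₂ ⊎ B₂ → A₁ ⊎ B₂ → A₂ ⊎ B₁ → ⊥
¬-C₄-cover-one-per-side ¬AA ¬BB (inj₁ a₁) (inj₁ a₂) _          _          = ¬AA (a₁ , a₂)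
¬-C₄-cover-one-per-side ¬AA ¬BB (inj₁ a₁) (inj₂ b₂) _          (inj₁ a₂) = ¬AA (a₁ , a₂)
¬-C₄-cover-one-per-side ¬AA ¬BB (inj₁ a₁) (inj₂ b₂) _          (inj₂ b₁) = ¬BB (b₁ , b₂)
¬-C₄-cover-one-per-side ¬AA ¬BB (inj₂ b₁) (inj₂ b₂) _          _          = ¬BB (b₁ , b₂)
¬-C₄-cover-one-per-side ¬AA ¬BB (inj₂ b₁) (inj₁ a₂) (inj₁ a₁) _          = ¬AA (a₁ , a₂)
¬-C₄-cover-one-per-side ¬AA ¬BB (inj₂ b₁) (inj₁ a₂) (inj₂ b₂) _          = ¬BB (b₁ , b₂)

pattern k₀ = zero
pattern k₁ = suc k₀
pattern k₂ = suc k₁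
pattern k₃ = suc k₂
pattern k₄ = suc k₃
pattern s₁ = suc k₄
pattern s₂ = suc s₁
pattern t₁ = suc s₂
pattern t₂ = suc t₁
pattern p₁ = suc t₂
pattern p₂ = suc p₁
pattern p₃ = suc p₂
pattern p₄ = suc p₃

inK : Fin 13 → Bool
inK i = toℕ i <ᵇ 5

-- k₀ has no neighbour outside the clique: the pendants added by Attach hang from it
joinedToClique : Fin 13 → Fin 13 → Bool
joinedToClique s₁ k₁ = true
joinedToClique s₁ k₃ = true
joinedToClique s₂ k₂ = true
joinedToClique s₂ k₄ = true
joinedToClique t₁ k₁ = true
joinedToClique t₁ k₄ = true
joinedToClique t₂ k₂ = true
joinedToClique t₂ k₃ = true
joinedToClique p₁ k₁ = true
joinedToClique p₂ k₂ = true
joinedToClique p₃ k₃ = true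
joinedToClique p₄ k₄ = true
joinedToClique _  _  = false

gadgetAdj : Fin 13 → Fin 13 → Bool
gadgetAdj u v = (inK u ∧ inK v ∧ not (does (u ≟ v))) ∨ joinedToClique u v ∨ joinedToClique v u

gadget : Graph 13
gadget = record
  { adj    = gadgetAdj
  ; sym    = from-yes (all? λ u → all? λ v → gadgetAdj u v Bool.≟ gadgetAdj v u)
  ; irrefl = from-yes (all? λ u → gadgetAdj u u Bool.≟ false)
  }

gadget-split : IsSplit gadget
gadget-split = inK
  , from-yes (all? λ u → all? λ v →
      ¬? (u ≟ v) →-dec inK u Bool.≟ true →-dec inK v Bool.≟ true →-dec adj? gadget u v)
  , from-yes (all? λ u → all? λ v →
      inK u Bool.≟ false →-dec inK v Bool.≟ false →-dec ¬? (adj? gadget u v))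

gadget-radius≤2 : ∀ u → Dist≤2 gadget u k₀
gadget-radius≤2 = from-yes (all? λ u → dist≤2? gadget u k₀)

Ds Dt : Subset 13
Ds = ⁅ s₁ ⁆ ∪ ⁅ s₂ ⁆
Dt = ⁅ t₁ ⁆ ∪ ⁅ t₂ ⁆

gadget-sequence : TJSeq gadget Ds Dt 3
gadget-sequence = step s₂ k₁ (step s₁ t₁ (step k₁ t₂ (tj-done (from-yes (isD2DS? gadget Dt)))))
  where
  step : ∀ {D D′ q} x y {_ : True (isD2DS? gadget D)} {_ : True (x ∈? D)} {_ : False (y ∈? D)} →
    TJSeq gadget (swap D x y) D′ q → TJSeq gadget D D′ (suc q)
  step x y {dominating} {x∈D} {y∉D} =
    tj-step (toWitness dominating) (swap-TJStep gadget (toWitness x∈D) (toWitnessFalse y∉D))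

DominatedOnlyBy : (p s t : Fin 13) → Set
DominatedOnlyBy p s t =
  ¬ (k₀ ≡ p ⊎ Adj gadget k₀ p) × (∀ i → i ∈ Ds ⊎ i ∈ Dt → Dist≤2 gadget i p → i ≡ s ⊎ i ≡ t)

dominatedOnlyBy? : ∀ p s t → Dec (DominatedOnlyBy p s t)
dominatedOnlyBy? p s t = ¬? (k₀ ≟ p ⊎-dec adj? gadget k₀ p)
  ×-dec all? λ i → (i ∈? Ds ⊎-dec i ∈? Dt) →-dec dist≤2? gadget i p →-dec (i ≟ s ⊎-dec i ≟ t)

module Instance (m : ℕ) where
  open Attach gadget k₀ m public

  Ds⁺ Dt⁺ : Subset (13 + m)
  Ds⁺ = lift Ds
  Dt⁺ = lift Dt

  token : ∀ i D {_ : True (i ∈? D)} → i ↑ˡ m ∈ lift D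
  token i D {i∈D} = ↑ˡ-∈-++⁺ (toWitness i∈D)

  nontoken : ∀ i D {_ : False (i ∈? D)} → i ↑ˡ m ∉ lift D
  nontoken i D {i∉D} = toWitnessFalse i∉D ∘ ↑ˡ-∈-++⁻ D i

  no-two-step-sequence : ∀ {D₁} → TJStep attach Ds⁺ D₁ → IsD2DS attach D₁ → TJStep attach D₁ Dt⁺ → ⊥
  no-two-step-sequence {D₁} step dominating step′ =
    ¬-C₄-cover-one-per-side one-s one-t
      (dominator p₁ s₁ t₁) (dominator p₂ s₂ t₂) (dominator p₃ s₁ t₂) (dominator p₄ s₂ t₁)
    where
    within : ∀ {u} → u ∈ D₁ → u ∈ Ds⁺ ⊎ u ∈ Dt⁺
    within = two-steps-stay-within attach step step′ (λ ())
      (token s₁ Ds) (nontoken s₁ Dt) (token s₂ Ds) (nontoken s₂ Dt)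

    dominator : ∀ p s t {_ : True (dominatedOnlyBy? p s t)} → s ↑ˡ m ∈ D₁ ⊎ t ↑ˡ m ∈ D₁
    dominator p s t {only} =
      far-vertex-dominated dominating within (proj₁ (toWitness only)) (proj₂ (toWitness only))

    one-s : ¬ (s₁ ↑ˡ m ∈ D₁ × s₂ ↑ˡ m ∈ D₁)
    one-s (s₁∈D₁ , s₂∈D₁) =
      contradiction (TJStep-removes-one attach step′ s₁∈D₁ (nontoken s₁ Dt) s₂∈D₁ (nontoken s₂ Dt)) λ ()

    one-t : ¬ (t₁ ↑ˡ m ∈ D₁ × t₂ ↑ˡ m ∈ D₁)
    one-t (t₁∈D₁ , t₂∈D₁) =
      contradiction (TJStep-adds-one attach step (nontoken t₁ Ds) t₁∈D₁ (nontoken t₂ Ds) t₂∈D₁) λ ()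

  shortest : ∀ q → TJSeq attach Ds⁺ Dt⁺ q → 3 ≤ q
  shortest _ (tj-step _ step (tj-done _)) =
    contradiction
      (TJStep-removes-one attach step (token s₁ Ds) (nontoken s₁ Dt) (token s₂ Ds) (nontoken s₂ Dt)) λ ()
  shortest _ (tj-step _ step (tj-step dominating step′ (tj-done _))) =
    ⊥-elim (no-two-step-sequence step dominating step′)
  shortest _ (tj-step _ _ (tj-step _ _ (tj-step _ _ _))) = s≤s (s≤s (s≤s z≤n))

lemma15 : (k : ℕ) → 2 ≤ k →
    Σ ℕ λ n → Σ (Graph n) λ G → IsConnected G × IsSplit G ×
      Σ (Subset n) λ Ds → Σ (Subset n) λ Dt →
        IsD2DS G Ds × IsD2DS G Dt × ∣ Ds ∣ ≡ k × ∣ Dt ∣ ≡ k ×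
        OptTJ≡ G Ds Dt (Mstar Ds Dt + 1)
lemma15 (suc (suc m)) (s≤s (s≤s z≤n)) =
  13 + m , attach , radius≤2⇒connected attach (k₀ ↑ˡ m) (attach-radius≤2 gadget-radius≤2) ,
  attach-split gadget-split refl , Ds⁺ , Dt⁺ ,
  lift-D2DS (from-yes (isD2DS? gadget Ds)) , lift-D2DS (from-yes (isD2DS? gadget Dt)) ,
  ∣lift∣ Ds , ∣lift∣ Dt ,
  subst (OptTJ≡ attach Ds⁺ Dt⁺) (cong (_+ 1) (≡.sym (Mstar-++ Ds Dt (⊤ {m}))))
    (lift-TJSeq gadget-sequence , shortest)
  where open Instance m
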